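{- Let $(G,\pi)$ be a parity game, $\tau$ a strategy for Odd, $T$ an $(n,d/2)$-universal tree, and $\mu:V\to\bar L(T)$ a node labeling such that $G_\tau$ has no loose arcs with respect to $\mu$. Consider the procedure BellmanFord which, given a node labeling $\nu$, repeats $n-1$ times: for every arc $vw\in E_\tau$ (in any order) set $\nu(v):=\mathrm{drop}(\nu,vw)$; and then returns $\nu$. If the input $\nu:V\to\bar L(T)$ satisfies $\nu\ge\mu^{\mathcal{G}^\uparrow_\tau}$ and $\nu(v)\le\widehat{\mu}(v)$ for all $v\in B(G_\tau)$, then BellmanFord returns $\mu^{\mathcal{G}^\uparrow_\tau}$.
   Context: A parity game: finite directed graph $G=(V,E)$, every node with an outgoing arc, $V=V_0\sqcup V_1$ (Even's and Odd's nodes), priorities $\pi:V\to\{1,\dots,d\}$, $d$ even, $n=|V|$. A strategy for Odd is $\tau:V_1\to V$ with $v\tau(v)\in E$; $G_\tau=(V,E_\tau)$ with $E_\tau=\{vw\in E:v\in V_0\}\cup\{v\tau(v):v\in V_1\}$. A strategy for Even is $\sigma:V_0\to V$ with $v\sigma(v)\in E$; $G_\sigma$ keeps all arcs out of $V_1$ and only $v\sigma(v)$ out of $v\in V_0$. For a subgraph $H$, $\pi(H)$ is the maximum priority in $H$, $H$ is even if $\pi(H)$ is even, $\Pi(H)$ is the set of nodes of $H$ with priority $\pi(H)$, and $v$ dominates $H$ if $v\in\Pi(H)$. Ordered trees: prefix-closed sets of tuples over a linearly ordered set, viewed as rooted trees, ordered lexicographically; in a tree of height $h$ all leaves have depth $h$,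 a leaf is $\xi=(\xi_{2h-1},\dots,\xi_1)$ and its $p$-truncation $\xi|_p$ deletes the components with index $<p$. $L(T)$ = leaves, $\bar L(T)=L(T)\cup\{\top\}$ with $\top$ maximal and $\top|_p=\top$. An $(\ell,h)$-universal tree is an ordered tree of height $h$ into which every ordered tree of height $h$ with at most $\ell$ leaves (all at depth $h$) embeds by an injective, edge-preserving, order-preserving, leaf-to-leaf map. A node labeling is $\mu:V\to\bar L(T)$, ordered pointwise. An arc $vw$ is non-violated w.r.t. $\mu$ if ($\pi(v)$ even and $\mu(v)|_{\pi(v)}\ge\mu(w)|_{\pi(v)}$) or ($\pi(v)$ odd and ($\mu(v)|_{\pi(v)}>\mu(w)|_{\pi(v)}$ or $\mu(v)=\mu(w)=\top$)); otherwise violated. It is tight if $\mu(v)$ is the smallest $\xi\in\bar L(T)$ such that $vw$ is non-violated after replacing $\mu(v)$ by $\xi$; loose if neither tight nor violated. $\mu$ is feasible in a subgraph $H$ if there is an Even strategy $\sigma$ with $v\sigma(v)\in E(H)$ for every $v\in V_0$ with an outgoing arc in $H$ such that all arcs of $H$ in $G_\sigma$ are non-violated. $\mu^{\mathcal{G}^\uparrow_\tau}$ is the pointwise least node labeling $\nu\ge\mu$ feasible in $G_\tau$ (it exists). For a labeling $\nu$ and arc $vw$, $\mathrm{drop}(\nu,vw)$ is the largest $\xi\in\bar L(T)$ with $\xi\le\nu(v)$ such that $vw$ is not loose after replacing $\nu(v)$ by $\xi$. A base node of $G_\tau$ is a node $v$ with $v\in\Pi(C)$ for some even cycle $C$ of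 $G_\tau$; $B(G_\tau)$ is the set of base nodes. The threshold label of $v\in B(G_\tau)$ is $\widehat{\mu}(v):=\min\{\tilde\mu(v):\tilde\mu:V\to\bar L(T),\ \tilde\mu(v)\ge\mu(v),\ \tilde\mu\text{ is feasible in some cycle dominated by }v\text{ in }G_\tau\}$. -}

module Defs where

open import Level using (0ℓ)
open import Data.Nat using (ℕ; zero; suc; _+_; _*_; _≤_; _∸_)
open import Data.Nat.Divisibility using (_∣_)
open import Data.Fin using (Fin)
open import Data.Bool using (Bool; true; false)
open import Data.List using (List; []; _∷_; _++_; [_]; length)
open import Data.List.Membership.Propositional using (_∈_)
open import Data.List.Relation.Unary.Unique.Propositional using (Unique)
open import Data.List.Relation.Binary.Lex.Core using (Lex-<)
open import Data.Product using (Σ; ∃; _×_; _,_)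
open import Data.Sum using (_⊎_)
open import Relation.Nullary using (¬_)
open import Relation.Binary.PropositionalEquality using (_≡_)
open import Relation.Binary.Structures using (IsStrictTotalOrder)
open import Data.Fin using (_≟_)
open import Relation.Nullary using (yes; no)

record LinOrd : Set₁ where
  field
    Carrier : Set
    _<_     : Carrier → Carrier → Set
    isSTO   : IsStrictTotalOrder _≡_ _<_

-- A (finite) ordered tree over a linearly ordered set: a finite,
-- prefix-closed set of tuples containing the root [].  The first list
-- element is the component closest to the root.
record Tree (A : LinOrd) : Set where
  open LinOrd A
  field
    nodes         : List (List Carrier)
    nodes-unique  : Unique nodes
    root          : [] ∈ nodes
    prefix-closed : ∀ xs ys → (xs ++ ys) ∈ nodes → xs ∈ nodes

module _ {A : LinOrd} where
  open LinOrd A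

  _<lex_ : List Carrier → List Carrier → Set
  _<lex_ = Lex-< _≡_ _<_

  IsLeaf : Tree A → List Carrier → Set
  IsLeaf T ξ = ξ ∈ Tree.nodes T × (∀ a → ¬ ((ξ ++ [ a ]) ∈ Tree.nodes T))

  HasHeight : Tree A → ℕ → Set
  HasHeight T h = ∀ ξ → IsLeaf T ξ → length ξ ≡ h

  AtMostLeaves : Tree A → ℕ → Set
  AtMostLeaves T ℓ = Σ (List (List Carrier)) λ ls →
    (∀ ξ → IsLeaf T ξ → ξ ∈ ls) × length ls ≤ ℓ

Embeds : {A B : LinOrd} → Tree A → Tree B → Set
Embeds {A} {B} S T = Σ (List (LinOrd.Carrier A) → List (LinOrd.Carrier B)) λ f →
    (∀ x → x ∈ Tree.nodes S → f x ∈ Tree.nodes T)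
  × (∀ x y → x ∈ Tree.nodes S → y ∈ Tree.nodes S → f x ≡ f y → x ≡ y)
  × (∀ x a → (x ++ [ a ]) ∈ Tree.nodes S → x ∈ Tree.nodes S →
        ∃ λ b → f (x ++ [ a ]) ≡ f x ++ [ b ])
  × (∀ x y → x ∈ Tree.nodes S → y ∈ Tree.nodes S → _<lex_ {A} x y → _<lex_ {B} (f x) (f y))
  × (∀ x → IsLeaf S x → IsLeaf T (f x))

Universal : {A : LinOrd} → ℕ → ℕ → Tree A → Set₁
Universal ℓ h T = HasHeight T h ×
  (∀ (B : LinOrd) (S : Tree B) → HasHeight S h → AtMostLeaves S ℓ → Embeds S T)

data Player : Set where
  Even Odd : Player

record ParityGame (n : ℕ) : Set where
  field
    d        : ℕ
    d-even   : 2 ∣ d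
    owner    : Fin n → Player          -- V₀ = Even's nodes, V₁ = Odd's nodes
    E        : Fin n → Fin n → Bool
    π        : Fin n → ℕ
    π-pos    : ∀ v → 1 ≤ π v
    π-le-d   : ∀ v → π v ≤ d
    total    : ∀ v → ∃ λ w → E v w ≡ true

-- "top"-extension L̄ = L ∪ {⊤}
data Ext (X : Set) : Set where
  fin : X → Ext X
  top : Ext X

module Game {n : ℕ} (G : ParityGame n) (A : LinOrd) (T : Tree A) where
  open ParityGame G public
  open LinOrd A

  V : Set
  V = Fin n

  Label : Set
  Label = Ext (List Carrier)

  InL̄ : Label → Set
  InL̄ x = x ≡ top ⊎ Σ (List Carrier) λ ξ → x ≡ fin ξ × IsLeaf T ξ

  _≤L_ : Label → Label → Set
  fin x ≤L fin y = x ≡ y ⊎ _<lex_ {A} x y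
  fin x ≤L top   = Data.Unit.⊤ where import Data.Unit
  top   ≤L fin y = Data.Empty.⊥ where import Data.Empty
  top   ≤L top   = Data.Unit.⊤ where import Data.Unit

  _<L_ : Label → Label → Set
  fin x <L fin y = _<lex_ {A} x y
  fin x <L top   = Data.Unit.⊤ where import Data.Unit
  top   <L _     = Data.Empty.⊥ where import Data.Empty

  -- p-truncation: delete the components with index < p, where the
  -- components of a tuple (ξ_{2k-1},…,ξ_1) carry the indices 2k-1,…,1
  trunc : ℕ → List Carrier → List Carrier
  trunc p []       = []
  trunc p (x ∷ xs) with p Data.Nat.≤? (2 * length xs + 1)
  ... | yes _ = x ∷ trunc p xs
  ... | no  _ = trunc p xs

  truncL : ℕ → Label → Label
  truncL p (fin ξ) = fin (trunc p ξ)
  truncL p top     = top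

  Labeling : Set
  Labeling = V → Label

  IsLabeling : Labeling → Set
  IsLabeling μ = ∀ v → InL̄ (μ v)

  _≤P_ : Labeling → Labeling → Set
  μ ≤P ν = ∀ v → μ v ≤L ν v

  _[_≔_] : Labeling → V → Label → Labeling
  (μ [ v ≔ ξ ]) u with u ≟ v
  ... | yes _ = ξ
  ... | no  _ = μ u

  NonViolated : Labeling → V → V → Set
  NonViolated μ v w =
      (2 ∣ π v × truncL (π v) (μ w) ≤L truncL (π v) (μ v))
    ⊎ (¬ (2 ∣ π v) × (truncL (π v) (μ w) <L truncL (π v) (μ v)
                       ⊎ (μ v ≡ top × μ w ≡ top)))

  Violated : Labeling → V → V → Set
  Violated μ v w = ¬ NonViolated μ v w

  Tight : Labeling → V → V → Set
  Tight μ v w = (InL̄ (μ v) × NonViolated μ v w)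
    × (∀ ξ → InL̄ ξ → NonViolated (μ [ v ≔ ξ ]) v w → μ v ≤L ξ)

  Loose : Labeling → V → V → Set
  Loose μ v w = ¬ Violated μ v w × ¬ Tight μ v w

  OddStrategy : Set
  OddStrategy = Σ (V → V) λ τ → ∀ v → owner v ≡ Odd → E v (τ v) ≡ true

  EvenStrategy : Set
  EvenStrategy = Σ (V → V) λ σ → ∀ v → owner v ≡ Even → E v (σ v) ≡ true

  Eτ : OddStrategy → V → V → Set
  Eτ (τ , _) v w = (owner v ≡ Even × E v w ≡ true) ⊎ (owner v ≡ Odd × w ≡ τ v)

  Eσ : EvenStrategy → V → V → Set
  Eσ (σ , _) v w = (owner v ≡ Odd × E v w ≡ true) ⊎ (owner v ≡ Even × w ≡ σ v)

  FeasibleIn : (V → V → Set) → Labeling → Set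
  FeasibleIn H μ = Σ EvenStrategy λ σ →
      (∀ v → owner v ≡ Even → (∃ λ w → H v w) → H v (Data.Product.proj₁ σ v))
    × (∀ v w → H v w → Eσ σ v w → NonViolated μ v w)

  IsLift : OddStrategy → Labeling → Labeling → Set
  IsLift τ μ μ↑ = P μ↑ × (∀ ν → P ν → μ↑ ≤P ν)
    where
    P : Labeling → Set
    P ν = IsLabeling ν × μ ≤P ν × FeasibleIn (Eτ τ) ν

  -- cycles of G_τ: nonempty lists of distinct nodes c₀,…,c_{k-1} with
  -- arcs c_i c_{i+1} and c_{k-1} c₀
  data Consec : List V → V → V → Set where
    here  : ∀ {x y xs} → Consec (x ∷ y ∷ xs) x y
    there : ∀ {x xs a b} → Consec xs a b → Consec (x ∷ xs) a b

  CycArc : List V → V → V → Set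
  CycArc []       v w = Data.Empty.⊥ where import Data.Empty
  CycArc (c ∷ cs) v w = Consec ((c ∷ cs) ++ [ c ]) v w

  IsCycle : OddStrategy → List V → Set
  IsCycle τ cs = ¬ (cs ≡ []) × Unique cs × (∀ v w → CycArc cs v w → Eτ τ v w)

  Dominates : V → List V → Set
  Dominates v cs = v ∈ cs × (∀ u → u ∈ cs → π u ≤ π v)

  IsBase : OddStrategy → V → Set
  IsBase τ v = Σ (List V) λ cs → IsCycle τ cs × Dominates v cs × 2 ∣ π v

  IsThreshold : OddStrategy → Labeling → V → Label → Set
  IsThreshold τ μ v ξ = P ξ × (∀ ξ' → P ξ' → ξ ≤L ξ')
    where
    P : Label → Set
    P x = Σ Labeling λ μ̃ → IsLabeling μ̃ × μ̃ v ≡ x × μ v ≤L μ̃ v ×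
          (Σ (List V) λ cs → IsCycle τ cs × Dominates v cs × FeasibleIn (CycArc cs) μ̃)

  IsDrop : Labeling → V → V → Label → Set
  IsDrop ν v w ξ = P ξ × (∀ ξ' → P ξ' → ξ' ≤L ξ)
    where
    P : Label → Set
    P x = InL̄ x × x ≤L ν v × ¬ Loose (ν [ v ≔ x ]) v w

  ArcOrder : OddStrategy → List (V × V) → Set
  ArcOrder τ ord = Unique ord × (∀ v w → ((v , w) ∈ ord → Eτ τ v w) × (Eτ τ v w → (v , w) ∈ ord))

  data Pass : Labeling → List (V × V) → Labeling → Set where
    done : ∀ {ν} → Pass ν [] ν
    step : ∀ {ν v w rest ν' ξ} → IsDrop ν v w ξ →
           Pass (ν [ v ≔ ξ ]) rest ν' → Pass ν ((v , w) ∷ rest) ν'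

  data BellmanFord (τ : OddStrategy) : ℕ → Labeling → Labeling → Set where
    stop  : ∀ {ν} → BellmanFord τ zero ν ν
    round : ∀ {k ν ν' ν'' ord} → ArcOrder τ ord → Pass ν ord ν' →
            BellmanFord τ k ν' ν'' → BellmanFord τ (suc k) ν ν''

-- Let μ↑ be the least lift and σ↑ an Even strategy witnessing its feasibility in G_τ; each node v has a
-- single arc v → s(v) in G_τ ∩ G_σ↑, and it is non-violated under μ↑.
-- A drop never takes ν below μ↑: on an arc vw of G_τ, μ↑(v) lies below every admissible label ζ, since
-- lowering μ↑(v) to ζ keeps the labeling feasible (redirect σ↑ at v to w) and above μ (μ has no loose arcs).
-- Dropping along v → s(v) makes ν(v) = μ↑(v) as soon as ν(s(v)) = μ↑(s(v)), so after k rounds every node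
-- whose s-orbit meets such a settled node within k steps is settled. Within n - 1 steps the s-orbit of any
-- node reaches the dominating node b of the cycle it ends in, and b is settled from the start: if π(b) is
-- odd then μ↑(b) = ⊤, for otherwise the π(b)-truncation of μ↑ would strictly decrease around the cycle;
-- if π(b) is even then b is a base node on whose cycle μ↑ is feasible, so ν(b) ≤ μ̂(b) ≤ μ↑(b). That
-- μ̂(b) exists holds only up to double negation, which suffices because the order on labels is decidable.

module Submission where

open import Defs
open import Data.Nat using (ℕ; _∸_)
open import Data.Nat.DivMod using (_/_)
open import Relation.Nullary using (¬_)
open import Relation.Binary.PropositionalEquality using (_≡_)

open import Level using (0ℓ)
open import Function using (_∘_)
open import Data.Bool using (true)
open import Data.Empty using (⊥-elim)
open import Data.Unit using (tt)
open import Data.Product using (Σ; ∃; _×_; _,_; proj₁; proj₂)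
open import Data.Sum using (_⊎_; inj₁; inj₂)
open import Data.Nat using (zero; suc; _+_; _*_; _≤_; _<_; _≤?_; z≤n; s≤s; s≤s⁻¹; z<s)
open import Data.Nat.Properties
  using (≤-trans; <⇒≤; n≤1+n; n<1+n; m<1+n⇒m<n∨m≡n; m<n⇒0<n∸m; m+[n∸m]≡n; <⇒≤pred; suc-injective;
         +-comm; +-monoˡ-≤; +-monoʳ-<; *-monoʳ-≤; anyUpTo?)
open import Data.Nat.GeneralisedArithmetic using (iterate)
open import Data.Nat.Divisibility using (_∣_; _∣?_)
open import Data.Fin using (Fin; toℕ; _≟_)
open import Data.Fin.Properties using (pigeonhole; toℕ<n)
open import Data.Vec.Functional using (updateAt)
open import Data.Vec.Functional.Properties using (updateAt-updates; updateAt-minimal)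
open import Data.List using (List; []; _∷_; _++_; [_]; map; applyUpTo; length)
open import Data.List.Properties using (∷-injective; applyUpTo-∷ʳ)
open import Data.List.Membership.Propositional using (_∈_)
open import Data.List.Membership.Propositional.Properties using (∈-applyUpTo⁺; ∈-applyUpTo⁻; ∈-map⁺)
open import Data.List.Relation.Unary.Any using (here; there)
import Data.List.Relation.Unary.All as All
open import Data.List.Relation.Unary.Unique.Propositional.Properties using (applyUpTo⁺₁)
open import Data.List.Extrema.Nat using (argmax; argmax-all; f[xs]≤f[argmax])
open import Data.List.Relation.Binary.Lex.Strict using (<-isStrictTotalOrder; this; next)
import Data.List.Relation.Binary.Pointwise as Pointwise
open import Effect.Monad using (RawMonad)
open import Relation.Nullary using (Dec; yes; no)
open import Relation.Nullary.Decidable using (¬¬-excluded-middle)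
open import Relation.Nullary.Negation using (Stable; ¬¬-Monad)
open import Relation.Unary using (Decidable)
open import Relation.Binary.Structures using (IsStrictTotalOrder)
open import Relation.Binary.Definitions using (tri<; tri≈; tri>)
open import Relation.Binary.PropositionalEquality
  using (_≢_; refl; sym; trans; cong; subst; subst₂; module ≡-Reasoning)

open RawMonad (¬¬-Monad {0ℓ}) using (return; _>>=_)

module _ {X : Set} (f : X → X) where

  iterate-suc : ∀ x k → iterate f x (suc k) ≡ f (iterate f x k)
  iterate-suc x zero    = refl
  iterate-suc x (suc k) = iterate-suc (f x) k

  iterate-+ : ∀ x a b → iterate f x (a + b) ≡ iterate f (iterate f x a) b
  iterate-+ x zero    b = refl
  iterate-+ x (suc a) b = iterate-+ (f x) a b

module _ {P : ℕ → Set} (P? : Decidable P) where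

  least-below : ∀ J → (∃ λ k → k < J × P k) → ∃ λ j → j < J × P j × (∀ {k} → k < j → ¬ P k)
  least-below (suc J) witness with anyUpTo? P? J
  ... | yes witness′ with j , j<J , Pj , least ← least-below J witness′ =
    j , ≤-trans j<J (n≤1+n J) , Pj , least
  ... | no none with k , k<1+J , Pk ← witness with m<1+n⇒m<n∨m≡n k<1+J
  ...   | inj₁ k<J  = ⊥-elim (none (k , k<J , Pk))
  ...   | inj₂ refl = k , k<1+J , Pk , λ i<k Pi → none (_ , i<k , Pi)

record Lasso {n : ℕ} (f : Fin n → Fin n) (u : Fin n) : Set where
  field
    stem period    : ℕ
    period>0       : 0 < period
    stem+period≤n  : stem + period ≤ n
    cycle-closes   : iterate f (iterate f u stem) period ≡ iterate f u stem
    cycle-distinct : ∀ {a b} → a < b → b < period →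
                     iterate f (iterate f u stem) a ≢ iterate f (iterate f u stem) b

-- The first repetition along the orbit of u, found by pigeonhole on its first n + 1 points.
lasso : ∀ {n} (f : Fin n → Fin n) u → Lasso f u
lasso {n} f u with i , j , i<j , fᵢ≡fⱼ ← pigeonhole (n<1+n n) (λ k → iterate f u (toℕ k))
  = first-repeat (least-below Repeats? (suc n) (toℕ j , toℕ<n j , toℕ i , i<j , fᵢ≡fⱼ))
  where
  Repeats : ℕ → Set
  Repeats J = ∃ λ i → i < J × iterate f u i ≡ iterate f u J

  Repeats? : Decidable Repeats
  Repeats? J = anyUpTo? (λ i → iterate f u i ≟ iterate f u J) J

  first-repeat : (∃ λ r → r < suc n × Repeats r × (∀ {k} → k < r → ¬ Repeats k)) → Lasso f u
  first-repeat (r , r<1+n , (s , s<r , fₛ≡fᵣ) , first) = record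
    { stem           = s
    ; period         = r ∸ s
    ; period>0       = m<n⇒0<n∸m s<r
    ; stem+period≤n  = subst (_≤ n) (sym s+p≡r) (s≤s⁻¹ r<1+n)
    ; cycle-closes   = trans (sym (iterate-+ f u s (r ∸ s))) (trans (cong (iterate f u) s+p≡r) (sym fₛ≡fᵣ))
    ; cycle-distinct = distinct
    }
    where
    s+p≡r : s + (r ∸ s) ≡ r
    s+p≡r = m+[n∸m]≡n (<⇒≤ s<r)

    distinct : ∀ {a b} → a < b → b < r ∸ s → iterate f (iterate f u s) a ≢ iterate f (iterate f u s) b
    distinct {a} {b} a<b b<p collide = first (subst (s + b <_) s+p≡r (+-monoʳ-< s b<p))
      (s + a , +-monoʳ-< s a<b , trans (iterate-+ f u s a) (trans collide (sym (iterate-+ f u s b))))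

module _ {n : ℕ} (G : ParityGame n) (A : LinOrd) (T : Tree A) where
  open Game G A T
  open LinOrd A using (Carrier; isSTO)

  private
    module Lex = IsStrictTotalOrder (<-isStrictTotalOrder isSTO)

  infix 4 _<ˡ_ _≤ˡ_

  _<ˡ_ : List Carrier → List Carrier → Set
  _<ˡ_ = _<lex_ {A}

  _≤ˡ_ : List Carrier → List Carrier → Set
  xs ≤ˡ ys = xs ≡ ys ⊎ xs <ˡ ys

  <ˡ-trans : ∀ {xs ys zs} → xs <ˡ ys → ys <ˡ zs → xs <ˡ zs
  <ˡ-trans = Lex.trans

  <ˡ-irrefl : ∀ {xs} → ¬ (xs <ˡ xs)
  <ˡ-irrefl = Lex.irrefl (Pointwise.≡⇒Pointwise-≡ refl)

  ≤L-refl : ∀ x → x ≤L x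
  ≤L-refl (fin _) = inj₁ refl
  ≤L-refl top     = tt

  ≤L-trans : ∀ {x y z} → x ≤L y → y ≤L z → x ≤L z
  ≤L-trans {fin _} {fin _} {fin _} (inj₁ refl) y≤z         = y≤z
  ≤L-trans {fin _} {fin _} {fin _} (inj₂ x<y)  (inj₁ refl)  = inj₂ x<y
  ≤L-trans {fin _} {fin _} {fin _} (inj₂ x<y)  (inj₂ y<z)   = inj₂ (<ˡ-trans x<y y<z)
  ≤L-trans {fin _} {_}     {top}   _           _            = tt
  ≤L-trans {top}   {top}   {top}   _           _            = tt

  <L⇒≤L : ∀ {x y} → x <L y → x ≤L y
  <L⇒≤L {fin _} {fin _} x<y = inj₂ x<y
  <L⇒≤L {fin _} {top}   _   = tt

  <L-irrefl : ∀ {x} → ¬ (x <L x)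
  <L-irrefl {fin _} = <ˡ-irrefl

  ≤L-<L-trans : ∀ {x y z} → x ≤L y → y <L z → x <L z
  ≤L-<L-trans {fin _} {fin _} {fin _} (inj₁ refl) y<z = y<z
  ≤L-<L-trans {fin _} {fin _} {fin _} (inj₂ x<y)  y<z = <ˡ-trans x<y y<z
  ≤L-<L-trans {fin _} {_}     {top}   _           _   = tt

  <L-≤L-trans : ∀ {x y z} → x <L y → y ≤L z → x <L z
  <L-≤L-trans {fin _} {fin _} {fin _} x<y (inj₁ refl) = x<y
  <L-≤L-trans {fin _} {fin _} {fin _} x<y (inj₂ y<z)  = <ˡ-trans x<y y<z
  <L-≤L-trans {fin _} {_}     {top}   _   _           = tt

  ≤L-antisym : ∀ {x y} → x ≤L y → y ≤L x → x ≡ y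
  ≤L-antisym {fin _} {fin _} (inj₁ refl) _           = refl
  ≤L-antisym {fin _} {fin _} (inj₂ _)    (inj₁ refl) = refl
  ≤L-antisym {fin _} {fin _} (inj₂ x<y)  (inj₂ y<x)  = ⊥-elim (<ˡ-irrefl (<ˡ-trans x<y y<x))
  ≤L-antisym {top}   {top}   _           _           = refl

  ≤L⊎>L : ∀ x y → x ≤L y ⊎ y <L x
  ≤L⊎>L (fin xs) (fin ys) with Lex.compare xs ys
  ... | tri< xs<ys _ _ = inj₁ (inj₂ xs<ys)
  ... | tri≈ _ xs≋ys _ = inj₁ (inj₁ (Pointwise.Pointwise-≡⇒≡ xs≋ys))
  ... | tri> _ _ ys<xs = inj₂ ys<xs
  ≤L⊎>L (fin _)  top     = inj₁ tt
  ≤L⊎>L top      (fin _) = inj₂ tt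
  ≤L⊎>L top      top     = inj₁ tt

  ≤L-stable : ∀ {x y} → Stable (x ≤L y)
  ≤L-stable {x} {y} ¬¬x≤y with ≤L⊎>L x y
  ... | inj₁ x≤y = x≤y
  ... | inj₂ y<x = ⊥-elim (¬¬x≤y λ x≤y → <L-irrefl (<L-≤L-trans y<x x≤y))

  x≤Ltop : ∀ x → x ≤L top
  x≤Ltop (fin _) = tt
  x≤Ltop top     = tt

  top≤L⇒≡top : ∀ {x} → top ≤L x → x ≡ top
  top≤L⇒≡top {top} _ = refl

  LeastIn : (Label → Set) → List Label → Label → Set
  LeastIn Q xs m = Q m × ∀ {y} → y ∈ xs → Q y → m ≤L y

  ¬¬-least-in : ∀ (Q : Label → Set) xs → ¬ ¬ ((∀ {y} → y ∈ xs → ¬ Q y) ⊎ ∃ (LeastIn Q xs))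
  ¬¬-least-in Q []       = return (inj₁ λ ())
  ¬¬-least-in Q (x ∷ xs) = do
    Q? ← ¬¬-excluded-middle
    least-in-xs ← ¬¬-least-in Q xs
    return (extend Q? least-in-xs)
    where
    extend : Dec (Q x) → (∀ {y} → y ∈ xs → ¬ Q y) ⊎ ∃ (LeastIn Q xs) →
             (∀ {y} → y ∈ x ∷ xs → ¬ Q y) ⊎ ∃ (LeastIn Q (x ∷ xs))
    extend (no ¬Qx) (inj₁ none)             = inj₁ λ { (here refl) → ¬Qx ; (there y∈xs) → none y∈xs }
    extend (no ¬Qx) (inj₂ (m , Qm , least)) =
      inj₂ (m , Qm , λ { (here refl) Qx → ⊥-elim (¬Qx Qx) ; (there y∈xs) → least y∈xs })
    extend (yes Qx) (inj₁ none)             =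
      inj₂ (x , Qx , λ { (here refl) _ → ≤L-refl x ; (there y∈xs) Qy → ⊥-elim (none y∈xs Qy) })
    extend (yes Qx) (inj₂ (m , Qm , least)) with ≤L⊎>L x m
    ... | inj₁ x≤m = inj₂ (x , Qx , λ { (here refl) _ → ≤L-refl x
                                      ; (there y∈xs) Qy → ≤L-trans x≤m (least y∈xs Qy) })
    ... | inj₂ m<x = inj₂ (m , Qm , λ { (here refl) _ → <L⇒≤L m<x ; (there y∈xs) Qy → least y∈xs Qy })

  labels : List Label
  labels = top ∷ map fin (Tree.nodes T)

  labels-complete : ∀ {x} → InL̄ x → x ∈ labels
  labels-complete (inj₁ refl)                   = here refl
  labels-complete (inj₂ (_ , refl , ξ∈T , _)) = there (∈-map⁺ fin ξ∈T)

  ¬¬-minimum : ∀ (Q : Label → Set) {x} → Q x → (∀ {y} → Q y → InL̄ y) →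
               ¬ ¬ (∃ λ m → Q m × ∀ y → Q y → m ≤L y)
  ¬¬-minimum Q Qx Q⊆L̄ = do
    inj₂ (m , Qm , least) ← ¬¬-least-in Q labels
      where inj₁ none → λ _ → none (labels-complete (Q⊆L̄ Qx)) Qx
    return (m , Qm , λ y Qy → least (labels-complete (Q⊆L̄ Qy)) Qy)

  trunc-keep : ∀ {p} x xs → p ≤ 2 * length xs + 1 → trunc p (x ∷ xs) ≡ x ∷ trunc p xs
  trunc-keep {p} x xs p≤ with p ≤? 2 * length xs + 1
  ... | yes _  = refl
  ... | no  p≰ = ⊥-elim (p≰ p≤)

  -- The components of a tuple carry decreasing indices, so once the head is cut off everything is.
  trunc-empty : ∀ {p} x xs → ¬ (p ≤ 2 * length xs + 1) → trunc p (x ∷ xs) ≡ []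
  trunc-empty {p} x xs p≰ with p ≤? 2 * length xs + 1
  ... | yes p≤ = ⊥-elim (p≰ p≤)
  trunc-empty {p} x []        p≰ | no _ = refl
  trunc-empty {p} x (y ∷ ys)  p≰ | no _ =
    trunc-empty y ys (λ p≤ → p≰ (≤-trans p≤ (+-monoˡ-≤ 1 (*-monoʳ-≤ 2 (n≤1+n _)))))

  trunc-zero : ∀ xs → trunc 0 xs ≡ xs
  trunc-zero []       = refl
  trunc-zero (x ∷ xs) = trans (trunc-keep x xs z≤n) (cong (x ∷_) (trunc-zero xs))

  ∷-≤ˡ : ∀ {x y xs ys} → x ≡ y → xs ≤ˡ ys → (x ∷ xs) ≤ˡ (y ∷ ys)
  ∷-≤ˡ refl (inj₁ refl)  = inj₁ refl
  ∷-≤ˡ refl (inj₂ xs<ys) = inj₂ (next refl xs<ys)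

  trunc-coarsen : ∀ {q p} → q ≤ p → ∀ xs ys → length xs ≡ length ys →
               trunc q xs ≤ˡ trunc q ys → trunc p xs ≤ˡ trunc p ys
  trunc-coarsen q≤p []       []       _  _ = inj₁ refl
  trunc-coarsen {q} {p} q≤p (x ∷ xs) (y ∷ ys) |x∷xs|≡|y∷ys| xs≤ys = cut (p ≤? 2 * length xs + 1)
    where
    |xs|≡|ys| = suc-injective |x∷xs|≡|y∷ys|

    at-ys : ∀ {P : ℕ → Set} → P (2 * length xs + 1) → P (2 * length ys + 1)
    at-ys {P} = subst (λ k → P (2 * k + 1)) |xs|≡|ys|

    heads : x ∷ trunc q xs ≤ˡ y ∷ trunc q ys → x ∷ trunc p xs ≤ˡ y ∷ trunc p ys
    heads (inj₁ x∷≡y∷) with refl , tails ← ∷-injective x∷≡y∷ =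
      ∷-≤ˡ refl (trunc-coarsen q≤p xs ys |xs|≡|ys| (inj₁ tails))
    heads (inj₂ (this x<y))      = inj₂ (this x<y)
    heads (inj₂ (next refl tl<)) = ∷-≤ˡ refl (trunc-coarsen q≤p xs ys |xs|≡|ys| (inj₂ tl<))

    cut : Dec (p ≤ 2 * length xs + 1) → trunc p (x ∷ xs) ≤ˡ trunc p (y ∷ ys)
    cut (no p≰) = subst₂ _≤ˡ_ (sym (trunc-empty x xs p≰))
                              (sym (trunc-empty y ys (at-ys {λ k → ¬ (p ≤ k)} p≰))) (inj₁ refl)
    cut (yes p≤) = subst₂ _≤ˡ_ (sym (trunc-keep x xs p≤)) (sym (trunc-keep y ys (at-ys {p ≤_} p≤)))
      (heads (subst₂ _≤ˡ_ (trunc-keep x xs q≤) (trunc-keep y ys (at-ys {q ≤_} q≤)) xs≤ys))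
      where q≤ = ≤-trans q≤p p≤

  -- NonViolated μ v w unfolds to Descent (π v) (μ v) (μ w).
  Descent : ℕ → Label → Label → Set
  Descent p x y = (2 ∣ p × truncL p y ≤L truncL p x)
                ⊎ (¬ (2 ∣ p) × (truncL p y <L truncL p x ⊎ (x ≡ top × y ≡ top)))

  Descent-loop-mono : ∀ {p x x′} → Descent p x x → x ≤L x′ → Descent p x′ x′
  Descent-loop-mono (inj₁ (even , _))                  _    = inj₁ (even , ≤L-refl _)
  Descent-loop-mono (inj₂ (_ , inj₁ x<x))              _    = ⊥-elim (<L-irrefl x<x)
  Descent-loop-mono (inj₂ (odd , inj₂ (refl , refl))) x≤x′ rewrite top≤L⇒≡top x≤x′ =
    inj₂ (odd , inj₂ (refl , refl))

  Descent-odd : ∀ {p ξ y} → ¬ (2 ∣ p) → Descent p (fin ξ) y → truncL p y <L truncL p (fin ξ)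
  Descent-odd odd (inj₁ (even , _))            = ⊥-elim (odd even)
  Descent-odd _   (inj₂ (_ , inj₁ y<x))        = y<x
  Descent-odd _   (inj₂ (_ , inj₂ (() , _)))

  ≔-cases : ∀ (P : Label → Set) μ v ξ u → (u ≡ v → P ξ) → (u ≢ v → P (μ u)) → P ((μ [ v ≔ ξ ]) u)
  ≔-cases P μ v ξ u same other with u ≟ v
  ... | yes u≡v = same u≡v
  ... | no  u≢v = other u≢v

  ≔-updates : ∀ μ v ξ → (μ [ v ≔ ξ ]) v ≡ ξ
  ≔-updates μ v ξ = ≔-cases (_≡ ξ) μ v ξ v (λ _ → refl) (λ v≢v → ⊥-elim (v≢v refl))

  ≔-minimal : ∀ μ v ξ {u} → u ≢ v → (μ [ v ≔ ξ ]) u ≡ μ u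
  ≔-minimal μ v ξ {u} u≢v = ≔-cases (_≡ μ u) μ v ξ u (λ u≡v → ⊥-elim (u≢v u≡v)) (λ _ → refl)

  ≔-self : ∀ μ v u → (μ [ v ≔ μ v ]) u ≡ μ u
  ≔-self μ v u = ≔-cases (_≡ μ u) μ v (μ v) u (λ { refl → refl }) (λ _ → refl)

  ≔-≔ : ∀ μ v ξ ζ u → ((μ [ v ≔ ξ ]) [ v ≔ ζ ]) u ≡ (μ [ v ≔ ζ ]) u
  ≔-≔ μ v ξ ζ u = ≔-cases (_≡ (μ [ v ≔ ζ ]) u) (μ [ v ≔ ξ ]) v ζ u
    (λ { refl → sym (≔-updates μ v ζ) })
    (λ u≢v → trans (≔-minimal μ v ξ u≢v) (sym (≔-minimal μ v ζ u≢v)))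

  ≔-IsLabeling : ∀ {μ} v {ξ} → IsLabeling μ → InL̄ ξ → IsLabeling (μ [ v ≔ ξ ])
  ≔-IsLabeling {μ} v {ξ} μ∈L̄ ξ∈L̄ u = ≔-cases InL̄ μ v ξ u (λ _ → ξ∈L̄) (λ _ → μ∈L̄ u)

  NonViolated-≗ : ∀ {μ μ′ v w} → (∀ u → μ u ≡ μ′ u) → NonViolated μ v w → NonViolated μ′ v w
  NonViolated-≗ {v = v} {w} μ≗μ′ = subst₂ (Descent (π v)) (μ≗μ′ v) (μ≗μ′ w)

  -- A record rather than a synonym, so that μ, v, w and ζ can be inferred from a proof.
  record Admissible (μ : Labeling) (v w : V) (ζ : Label) : Set where
    constructor admissible
    field nonViolated : NonViolated (μ [ v ≔ ζ ]) v w
  open Admissible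

  NonViolated⇒Admissible : ∀ {μ v w} → NonViolated μ v w → Admissible μ v w (μ v)
  NonViolated⇒Admissible {μ} {v} {w} nv = admissible (NonViolated-≗ {v = v} {w} (λ u → sym (≔-self μ v u)) nv)

  Admissible⇒NonViolated : ∀ {μ v w} → Admissible μ v w (μ v) → NonViolated μ v w
  Admissible⇒NonViolated {μ} {v} {w} (admissible nv) = NonViolated-≗ {v = v} {w} (≔-self μ v) nv

  Admissible-≔⁺ : ∀ {μ v w ξ ζ} → Admissible μ v w ζ → Admissible (μ [ v ≔ ξ ]) v w ζ
  Admissible-≔⁺ {μ} {v} {w} {ξ} {ζ} (admissible nv) =
    admissible (NonViolated-≗ {v = v} {w} (λ u → sym (≔-≔ μ v ξ ζ u)) nv)

  Admissible-≔⁻ : ∀ {μ v w ξ ζ} → Admissible (μ [ v ≔ ξ ]) v w ζ → Admissible μ v w ζ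
  Admissible-≔⁻ {μ} {v} {w} {ξ} {ζ} (admissible nv) = admissible (NonViolated-≗ {v = v} {w} (≔-≔ μ v ξ ζ) nv)

  Admissible⇒Descent : ∀ {μ v w ζ} → Admissible μ v w ζ → Descent (π v) ζ ((μ [ v ≔ ζ ]) w)
  Admissible⇒Descent {μ} {v} {w} {ζ} (admissible nv) =
    subst (λ x → Descent (π v) x ((μ [ v ≔ ζ ]) w)) (≔-updates μ v ζ) nv

  Descent⇒Admissible : ∀ {μ v w ζ} → Descent (π v) ζ ((μ [ v ≔ ζ ]) w) → Admissible μ v w ζ
  Descent⇒Admissible {μ} {v} {w} {ζ} d =
    admissible (subst (λ x → Descent (π v) x ((μ [ v ≔ ζ ]) w)) (sym (≔-updates μ v ζ)) d)

  Consec-applyUpTo : ∀ (g : ℕ → V) m {a b} → Consec (applyUpTo g m) a b → ∃ λ k → a ≡ g k × b ≡ g (suc k)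
  Consec-applyUpTo g (suc (suc m)) here        = 0 , refl , refl
  Consec-applyUpTo g (suc m)       (there arc) with k , a≡ , b≡ ← Consec-applyUpTo (g ∘ suc) m arc =
    suc k , a≡ , b≡

  module _ {h : ℕ} (height : HasHeight T h) where

    length-label : ∀ {ξ} → InL̄ (fin ξ) → length ξ ≡ h
    length-label (inj₂ (ξ , refl , leaf)) = height ξ leaf

    truncL-coarsen : ∀ {q p} → q ≤ p → ∀ {x y} → InL̄ x → InL̄ y →
                     truncL q x ≤L truncL q y → truncL p x ≤L truncL p y
    truncL-coarsen q≤p {fin xs} {fin ys} x∈L̄ y∈L̄ =
      trunc-coarsen q≤p xs ys (trans (length-label x∈L̄) (sym (length-label y∈L̄)))
    truncL-coarsen q≤p {_}      {top}    _   _   _ = x≤Ltop _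

    truncL-mono : ∀ p {x y} → InL̄ x → InL̄ y → x ≤L y → truncL p x ≤L truncL p y
    truncL-mono p {x} {y} x∈L̄ y∈L̄ x≤y =
      truncL-coarsen z≤n x∈L̄ y∈L̄ (subst₂ _≤L_ (sym (truncL-zero x)) (sym (truncL-zero y)) x≤y)
      where
      truncL-zero : ∀ x → truncL 0 x ≡ x
      truncL-zero (fin xs) = cong fin (trunc-zero xs)
      truncL-zero top      = refl

    Descent-mono : ∀ {p x x′ y y′} → InL̄ x → InL̄ x′ → InL̄ y → InL̄ y′ →
                   Descent p x y → x ≤L x′ → y′ ≤L y → Descent p x′ y′
    Descent-mono {p} x∈ x′∈ y∈ y′∈ (inj₁ (even , y≤x)) x≤x′ y′≤y =
      inj₁ (even , ≤L-trans (truncL-mono p y′∈ y∈ y′≤y) (≤L-trans y≤x (truncL-mono p x∈ x′∈ x≤x′)))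
    Descent-mono {p} x∈ x′∈ y∈ y′∈ (inj₂ (odd , inj₁ y<x)) x≤x′ y′≤y =
      inj₂ (odd , inj₁ (≤L-<L-trans (truncL-mono p y′∈ y∈ y′≤y)
                                    (<L-≤L-trans y<x (truncL-mono p x∈ x′∈ x≤x′))))
    Descent-mono {y′ = y′} _ _ _ _ (inj₂ (odd , inj₂ (refl , refl))) x≤x′ _
      rewrite top≤L⇒≡top x≤x′ with y′
    ... | top   = inj₂ (odd , inj₂ (refl , refl))
    ... | fin _ = inj₂ (odd , inj₁ tt)

    Descent⇒truncL-≤ : ∀ {q p} → q ≤ p → ∀ {x y} → InL̄ x → InL̄ y →
                       Descent q x y → truncL p y ≤L truncL p x
    Descent⇒truncL-≤ q≤p x∈ y∈ (inj₁ (_ , y≤x))                = truncL-coarsen q≤p y∈ x∈ y≤x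
    Descent⇒truncL-≤ q≤p x∈ y∈ (inj₂ (_ , inj₁ y<x))           = truncL-coarsen q≤p y∈ x∈ (<L⇒≤L y<x)
    Descent⇒truncL-≤ q≤p x∈ y∈ (inj₂ (_ , inj₂ (refl , refl))) = tt

    Admissible-upward : ∀ {μ v w ζ ζ′} → InL̄ ζ → InL̄ ζ′ → InL̄ (μ w) →
                        Admissible μ v w ζ → ζ ≤L ζ′ → Admissible μ v w ζ′
    Admissible-upward {μ} {v} {w} {ζ} {ζ′} ζ∈ ζ′∈ μw∈ adm ζ≤ζ′ =
      Descent⇒Admissible (raise (Admissible⇒Descent adm))
      where
      raise : Descent (π v) ζ ((μ [ v ≔ ζ ]) w) → Descent (π v) ζ′ ((μ [ v ≔ ζ′ ]) w)
      raise with w ≟ v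
      ... | yes refl = λ loop → Descent-loop-mono loop ζ≤ζ′
      ... | no  _    = λ d → Descent-mono ζ∈ ζ′∈ μw∈ μw∈ d ζ≤ζ′ (≤L-refl _)

    Admissible-antitone : ∀ {μ μ′ v w ζ} → InL̄ ζ → InL̄ (μ w) → InL̄ (μ′ w) →
                          μ′ w ≤L μ w → Admissible μ v w ζ → Admissible μ′ v w ζ
    Admissible-antitone {μ} {μ′} {v} {w} {ζ} ζ∈ μw∈ μ′w∈ μ′w≤μw adm =
      Descent⇒Admissible (lower (Admissible⇒Descent adm))
      where
      lower : Descent (π v) ζ ((μ [ v ≔ ζ ]) w) → Descent (π v) ζ ((μ′ [ v ≔ ζ ]) w)
      lower with w ≟ v
      ... | yes refl = λ loop → loop
      ... | no  _    = λ d → Descent-mono ζ∈ ζ∈ μw∈ μ′w∈ d (≤L-refl _) μ′w≤μw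

    -- Not loose means vw is violated or tight; either way μ(v) lies below every admissible label.
    ¬Loose⇒≤Admissible : ∀ {μ v w} → InL̄ (μ v) → InL̄ (μ w) → ¬ Loose μ v w →
                          ∀ ζ → InL̄ ζ → Admissible μ v w ζ → μ v ≤L ζ
    ¬Loose⇒≤Admissible {μ} {v} {w} μv∈ μw∈ ¬loose ζ ζ∈ adm with ≤L⊎>L (μ v) ζ
    ... | inj₁ μv≤ζ = μv≤ζ
    ... | inj₂ ζ<μv = ⊥-elim (¬loose (not-violated , not-tight))
      where
      not-violated : ¬ Violated μ v w
      not-violated violated = violated (Admissible⇒NonViolated (Admissible-upward ζ∈ μv∈ μw∈ adm (<L⇒≤L ζ<μv)))

      not-tight : ¬ Tight μ v w
      not-tight tight = <L-irrefl (<L-≤L-trans ζ<μv (proj₂ tight ζ ζ∈ (nonViolated adm)))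

    drop-≤-Admissible : ∀ {ν v w ξ} → IsLabeling ν → IsDrop ν v w ξ →
                        ∀ ζ → InL̄ ζ → Admissible ν v w ζ → ξ ≤L ζ
    drop-≤-Admissible {ν} {v} {w} {ξ} ν∈ ((ξ∈ , _ , ¬loose) , _) ζ ζ∈ adm =
      subst (_≤L ζ) (≔-updates ν v ξ)
        (¬Loose⇒≤Admissible (ν′∈ v) (ν′∈ w) ¬loose ζ ζ∈ (Admissible-≔⁺ adm))
      where
      ν′∈ = ≔-IsLabeling v ν∈ ξ∈

    drop-≥-lowerBound : ∀ {ν v w ξ} → IsDrop ν v w ξ → ∀ ζ → InL̄ ζ → ζ ≤L ν v →
                        (∀ ζ′ → InL̄ ζ′ → Admissible ν v w ζ′ → ζ ≤L ζ′) → ζ ≤L ξ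
    drop-≥-lowerBound {ν} {v} {w} (_ , maximal) ζ ζ∈ ζ≤νv lowerBound = maximal ζ (ζ∈ , ζ≤νv , ¬loose)
      where
      tight : NonViolated (ν [ v ≔ ζ ]) v w → Tight (ν [ v ≔ ζ ]) v w
      tight nv = (subst InL̄ (sym (≔-updates ν v ζ)) ζ∈ , nv)
               , λ ζ′ ζ′∈ nv′ → subst (_≤L ζ′) (sym (≔-updates ν v ζ))
                                      (lowerBound ζ′ ζ′∈ (Admissible-≔⁻ (admissible nv′)))

      ¬loose : ¬ Loose (ν [ v ≔ ζ ]) v w
      ¬loose (¬violated , ¬tight) = ¬violated (λ nv → ¬tight (tight nv))

    module _ (τ : OddStrategy) {μ μ↑ : Labeling} (μ∈ : IsLabeling μ)
             (μ-¬loose : ∀ v w → Eτ τ v w → ¬ Loose μ v w) (lift : IsLift τ μ μ↑) where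

      μ↑∈ : IsLabeling μ↑
      μ↑∈ = proj₁ (proj₁ lift)

      μ≤μ↑ : μ ≤P μ↑
      μ≤μ↑ = proj₁ (proj₂ (proj₁ lift))

      σ↑ : EvenStrategy
      σ↑ = proj₁ (proj₂ (proj₂ (proj₁ lift)))

      σ↑-stays-in-Gτ : ∀ v → owner v ≡ Even → (∃ λ w → Eτ τ v w) → Eτ τ v (proj₁ σ↑ v)
      σ↑-stays-in-Gτ = proj₁ (proj₂ (proj₂ (proj₂ (proj₁ lift))))

      μ↑-feasible : ∀ v w → Eτ τ v w → Eσ σ↑ v w → NonViolated μ↑ v w
      μ↑-feasible = proj₂ (proj₂ (proj₂ (proj₂ (proj₁ lift))))

      μ↑-least : ∀ ν → IsLabeling ν × μ ≤P ν × FeasibleIn (Eτ τ) ν → μ↑ ≤P ν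
      μ↑-least = proj₂ lift

      Eτ-even : ∀ {v w} → owner v ≡ Even → Eτ τ v w → E v w ≡ true
      Eτ-even _    (inj₁ (_ , vw∈E)) = vw∈E
      Eτ-even even (inj₂ (odd , _)) with () ← trans (sym even) odd

      Eτ-odd : ∀ {v w} → owner v ≡ Odd → Eτ τ v w → w ≡ proj₁ τ v
      Eτ-odd odd (inj₁ (even , _)) with () ← trans (sym odd) even
      Eτ-odd _   (inj₂ (_ , w≡τv)) = w≡τv

      -- Lowering μ↑(v) to an admissible ζ keeps it feasible, once Even's strategy at v is redirected to w.
      module Lowering {v w : V} (vw∈Eτ : Eτ τ v w) {ζ : Label} (ζ∈ : InL̄ ζ)
                      (adm : Admissible μ↑ v w ζ) (ζ≤μ↑v : ζ ≤L μ↑ v) where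

        μ′ : Labeling
        μ′ = μ↑ [ v ≔ ζ ]

        μ′∈ : IsLabeling μ′
        μ′∈ = ≔-IsLabeling v μ↑∈ ζ∈

        μ′≤μ↑ : μ′ ≤P μ↑
        μ′≤μ↑ u = ≔-cases (_≤L μ↑ u) μ↑ v ζ u (λ { refl → ζ≤μ↑v }) (λ _ → ≤L-refl _)

        μ≤μ′ : μ ≤P μ′
        μ≤μ′ u = ≔-cases (μ u ≤L_) μ↑ v ζ u (λ { refl → μv≤ζ }) (λ _ → μ≤μ↑ u)
          where
          μv≤ζ : μ v ≤L ζ
          μv≤ζ = ¬Loose⇒≤Admissible (μ∈ v) (μ∈ w) (μ-¬loose v w vw∈Eτ) ζ ζ∈
                   (Admissible-antitone ζ∈ (μ↑∈ w) (μ∈ w) (μ≤μ↑ w) adm)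

        σ′ : V → V
        σ′ = updateAt (proj₁ σ↑) v (λ _ → w)

        σ′-at-v : σ′ v ≡ w
        σ′-at-v = updateAt-updates v (proj₁ σ↑)

        σ′-elsewhere : ∀ {u} → u ≢ v → σ′ u ≡ proj₁ σ↑ u
        σ′-elsewhere {u} = updateAt-minimal u v (proj₁ σ↑)

        σ′-strategy : EvenStrategy
        σ′-strategy = σ′ , legal
          where
          legal : ∀ u → owner u ≡ Even → E u (σ′ u) ≡ true
          legal u even with u ≟ v
          ... | yes refl = subst (λ x → E v x ≡ true) (sym σ′-at-v) (Eτ-even even vw∈Eτ)
          ... | no  u≢v  = subst (λ x → E u x ≡ true) (sym (σ′-elsewhere u≢v)) (proj₂ σ↑ u even)

        σ′-stays-in-Gτ : ∀ u → owner u ≡ Even → (∃ λ w′ → Eτ τ u w′) → Eτ τ u (σ′ u)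
        σ′-stays-in-Gτ u even out with u ≟ v
        ... | yes refl = subst (Eτ τ v) (sym σ′-at-v) vw∈Eτ
        ... | no  u≢v  = subst (Eτ τ u) (sym (σ′-elsewhere u≢v)) (σ↑-stays-in-Gτ u even out)

        μ′-feasible : ∀ u w′ → Eτ τ u w′ → Eσ σ′-strategy u w′ → NonViolated μ′ u w′
        μ′-feasible u w′ uw′∈Eτ uw′∈Eσ = by-cases (u ≟ v)
          where
          by-cases : Dec (u ≡ v) → NonViolated μ′ u w′
          by-cases (yes refl) = subst (NonViolated μ′ v) (sym (only-w uw′∈Eσ)) (nonViolated adm)
            where
            only-w : Eσ σ′-strategy v w′ → w′ ≡ w
            only-w (inj₁ (odd , _))    = trans (Eτ-odd odd uw′∈Eτ) (sym (Eτ-odd odd vw∈Eτ))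
            only-w (inj₂ (_ , w′≡σ′v)) = trans w′≡σ′v σ′-at-v
          by-cases (no u≢v) = Descent-mono (μ↑∈ u) (μ′∈ u) (μ↑∈ w′) (μ′∈ w′)
                                (μ↑-feasible u w′ uw′∈Eτ (in-Gσ↑ uw′∈Eσ))
                                (subst (μ↑ u ≤L_) (sym (≔-minimal μ↑ v ζ u≢v)) (≤L-refl _)) (μ′≤μ↑ w′)
            where
            in-Gσ↑ : Eσ σ′-strategy u w′ → Eσ σ↑ u w′
            in-Gσ↑ (inj₁ odd-arc)         = inj₁ odd-arc
            in-Gσ↑ (inj₂ (even , w′≡σ′u)) = inj₂ (even , trans w′≡σ′u (σ′-elsewhere u≢v))

        μ′-candidate : IsLabeling μ′ × μ ≤P μ′ × FeasibleIn (Eτ τ) μ′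
        μ′-candidate = μ′∈ , μ≤μ′ , σ′-strategy , σ′-stays-in-Gτ , μ′-feasible

      μ↑-≤-Admissible : ∀ {v w} → Eτ τ v w → ∀ ζ → InL̄ ζ → Admissible μ↑ v w ζ → μ↑ v ≤L ζ
      μ↑-≤-Admissible {v} vw∈Eτ ζ ζ∈ adm with ≤L⊎>L (μ↑ v) ζ
      ... | inj₁ μ↑v≤ζ = μ↑v≤ζ
      ... | inj₂ ζ<μ↑v = subst (μ↑ v ≤L_) (≔-updates μ↑ v ζ) (μ↑-least μ′ μ′-candidate v)
        where open Lowering vw∈Eτ ζ∈ adm (<L⇒≤L ζ<μ↑v)

      move : Player → V → V
      move Even = proj₁ σ↑
      move Odd  = proj₁ τ

      -- The unique arc out of each node in G_τ ∩ G_σ↑.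
      successor : V → V
      successor v = move (owner v) v

      successor-arc : ∀ v → Eτ τ v (successor v) × NonViolated μ↑ v (successor v)
      successor-arc v = by-owner (owner v) refl
        where
        by-owner : ∀ p → owner v ≡ p → Eτ τ v (move p v) × NonViolated μ↑ v (move p v)
        by-owner Even even = arc , μ↑-feasible v _ arc (inj₂ (even , refl))
          where arc = inj₁ (even , proj₂ σ↑ v even)
        by-owner Odd  odd  = arc , μ↑-feasible v _ arc (inj₁ (odd , proj₂ τ v odd))
          where arc = inj₂ (odd , refl)

      successor-even : ∀ {v} → owner v ≡ Even → successor v ≡ proj₁ σ↑ v
      successor-even even rewrite even = refl

      Above : Labeling → Set
      Above ν = IsLabeling ν × μ↑ ≤P ν

      Settled : Labeling → V → Set
      Settled ν u = ν u ≤L μ↑ u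

      BelowThresholds : Labeling → Set
      BelowThresholds ν = ∀ v → IsBase τ v → ∀ ξ → IsThreshold τ μ v ξ → ν v ≤L ξ

      drop-step : ∀ {ν v w ξ} → Above ν → Eτ τ v w → IsDrop ν v w ξ →
                  Above (ν [ v ≔ ξ ]) × (ν [ v ≔ ξ ]) ≤P ν
      drop-step {ν} {v} {w} {ξ} (ν∈ , μ↑≤ν) vw∈Eτ drop@((ξ∈ , ξ≤νv , _) , _) =
        (≔-IsLabeling v ν∈ ξ∈ , above) , below
        where
        μ↑v≤ξ : μ↑ v ≤L ξ
        μ↑v≤ξ = drop-≥-lowerBound drop (μ↑ v) (μ↑∈ v) (μ↑≤ν v) λ ζ ζ∈ adm →
          μ↑-≤-Admissible vw∈Eτ ζ ζ∈ (Admissible-antitone ζ∈ (ν∈ w) (μ↑∈ w) (μ↑≤ν w) adm)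

        above : μ↑ ≤P (ν [ v ≔ ξ ])
        above u = ≔-cases (μ↑ u ≤L_) ν v ξ u (λ { refl → μ↑v≤ξ }) (λ _ → μ↑≤ν u)

        below : (ν [ v ≔ ξ ]) ≤P ν
        below u = ≔-cases (_≤L ν u) ν v ξ u (λ { refl → ξ≤νv }) (λ _ → ≤L-refl _)

      drop-settles : ∀ {ν v ξ} → Above ν → IsDrop ν v (successor v) ξ →
                     Settled ν (successor v) → ξ ≤L μ↑ v
      drop-settles {ν} {v} (ν∈ , _) drop settled = drop-≤-Admissible ν∈ drop (μ↑ v) (μ↑∈ v)
        (Admissible-antitone {μ↑} {ν} (μ↑∈ v) (μ↑∈ (successor v)) (ν∈ (successor v)) settled
          (NonViolated⇒Admissible {μ↑} (proj₂ (successor-arc v))))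

      pass-settles : ∀ {ν ord ν′} → Pass ν ord ν′ → (∀ {v w} → (v , w) ∈ ord → Eτ τ v w) → Above ν →
                     Above ν′ × ν′ ≤P ν ×
                     (∀ u → (u , successor u) ∈ ord → Settled ν (successor u) → Settled ν′ u)
      pass-settles done _ above = above , (λ _ → ≤L-refl _) , λ _ ()
      pass-settles {ν} {(v , w) ∷ ord} {ν′} (step {ξ = ξ} drop rest) ord⊆Eτ above
        with above₁ , ν₁≤ν ← drop-step above (ord⊆Eτ (here refl)) drop
        with above′ , ν′≤ν₁ , settles ← pass-settles rest (ord⊆Eτ ∘ there) above₁
        = above′ , (λ u → ≤L-trans (ν′≤ν₁ u) (ν₁≤ν u)) , settles′
        where
        settles′ : ∀ u → (u , successor u) ∈ (v , w) ∷ ord → Settled ν (successor u) → Settled ν′ u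
        settles′ u (here refl) s =
          ≤L-trans (ν′≤ν₁ u) (subst (_≤L μ↑ u) (sym (≔-updates ν u ξ)) (drop-settles above drop s))
        settles′ u (there uv∈ord) s = settles u uv∈ord (≤L-trans (ν₁≤ν (successor u)) s)

      bellmanFord-settles : ∀ {k ν ν′} → BellmanFord τ k ν ν′ → Above ν →
                            Above ν′ × (∀ u j → j ≤ k → Settled ν (iterate successor u j) → Settled ν′ u)
      bellmanFord-settles stop above = above , λ { u zero z≤n s → s }
      bellmanFord-settles {suc k} {ν} {ν′} (round order pass rounds) above
        with above₁ , ν₁≤ν , pass-settle ← pass-settles pass (λ {v} {w} → proj₁ (proj₂ order v w)) above
        with above′ , settles ← bellmanFord-settles rounds above₁
        = above′ , settles′
        where
        settles′ : ∀ u j → j ≤ suc k → Settled ν (iterate successor u j) → Settled ν′ u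
        settles′ u zero    _         s = settles u zero z≤n (≤L-trans (ν₁≤ν u) s)
        settles′ u (suc j) (s≤s j≤k) s = settles u j j≤k
          (pass-settle (iterate successor u j) (proj₂ (proj₂ order _ _) (proj₁ (successor-arc _)))
            (subst (Settled ν) (iterate-suc successor u j) s))

      truncL-descends : ∀ p x k → (∀ i → i < k → π (iterate successor x i) ≤ p) →
                        truncL p (μ↑ (iterate successor x k)) ≤L truncL p (μ↑ x)
      truncL-descends p x zero    _       = ≤L-refl _
      truncL-descends p x (suc k) bounded =
        ≤L-trans (truncL-descends p (successor x) k (λ i i<k → bounded (suc i) (s≤s i<k)))
                 (Descent⇒truncL-≤ (bounded 0 z<s) (μ↑∈ x) (μ↑∈ (successor x)) (proj₂ (successor-arc x)))

      module OrbitCycle (c : V) (ℓ : ℕ) (closes : iterate successor c (suc ℓ) ≡ c)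
                        (distinct : ∀ {a b} → a < b → b < suc ℓ →
                                    iterate successor c a ≢ iterate successor c b) where

        orbit : ℕ → V
        orbit = iterate successor c

        cs : List V
        cs = applyUpTo orbit (suc ℓ)

        c∈cs : c ∈ cs
        c∈cs = here refl

        cs-arc : ∀ {a b} → CycArc cs a b → b ≡ successor a
        cs-arc {a} {b} arc
          with k , refl , refl ← Consec-applyUpTo orbit (suc (suc ℓ))
                                   (subst (λ l → Consec l a b) (applyUpTo-∷ʳ orbit (suc ℓ))
                                     (subst (λ x → Consec (cs ++ [ x ]) a b) (sym closes) arc))
          = iterate-suc successor c k

        cs-IsCycle : IsCycle τ cs
        cs-IsCycle = (λ ()) , applyUpTo⁺₁ orbit (suc ℓ) distinct
                   , λ v w arc → subst (Eτ τ v) (sym (cs-arc arc)) (proj₁ (successor-arc v))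

        successor-∈-cs : ∀ {x} → x ∈ cs → successor x ∈ cs
        successor-∈-cs x∈cs with k , k<1+ℓ , refl ← ∈-applyUpTo⁻ orbit x∈cs
          rewrite sym (iterate-suc successor c k) with m<1+n⇒m<n∨m≡n (s≤s k<1+ℓ)
        ... | inj₁ 1+k<1+ℓ = ∈-applyUpTo⁺ orbit 1+k<1+ℓ
        ... | inj₂ refl    = subst (_∈ cs) (sym closes) c∈cs

        iterate-∈-cs : ∀ {x} → x ∈ cs → ∀ k → iterate successor x k ∈ cs
        iterate-∈-cs x∈cs zero    = x∈cs
        iterate-∈-cs x∈cs (suc k) = iterate-∈-cs (successor-∈-cs x∈cs) k

        cs-periodic : ∀ {x} → x ∈ cs → iterate successor x (suc ℓ) ≡ x
        cs-periodic x∈cs with m , _ , refl ← ∈-applyUpTo⁻ orbit x∈cs = begin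
          iterate successor (orbit m) (suc ℓ)  ≡⟨ iterate-+ successor c m (suc ℓ) ⟨
          orbit (m + suc ℓ)                    ≡⟨ cong orbit (+-comm m (suc ℓ)) ⟩
          orbit (suc ℓ + m)                    ≡⟨ iterate-+ successor c (suc ℓ) m ⟩
          iterate successor (orbit (suc ℓ)) m  ≡⟨ cong (λ x → iterate successor x m) closes ⟩
          orbit m                              ∎
          where open ≡-Reasoning

        base : V
        base = argmax π c cs

        base-dominates : Dominates base cs
        base-dominates = argmax-all π {P = _∈ cs} c∈cs (All.tabulate (λ x∈cs → x∈cs))
                       , λ u u∈cs → All.lookup (f[xs]≤f[argmax] {f = π} c cs) u∈cs

        -- Around the cycle the p-truncation of μ↑ never increases, but at an odd base it must strictly decrease.
        base-odd⇒top : ¬ (2 ∣ π base) → μ↑ base ≡ top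
        base-odd⇒top odd with μ↑ base in μ↑base≡
        ... | top   = refl
        ... | fin ξ = ⊥-elim (<L-irrefl (≤L-<L-trans around (Descent-odd odd first-arc)))
          where
          p = π base

          first-arc : Descent p (fin ξ) (μ↑ (successor base))
          first-arc = subst (λ x → Descent p x (μ↑ (successor base))) μ↑base≡ (proj₂ (successor-arc base))

          around : truncL p (fin ξ) ≤L truncL p (μ↑ (successor base))
          around = subst (λ x → truncL p x ≤L truncL p (μ↑ (successor base)))
                         (trans (cong μ↑ (cs-periodic (proj₁ base-dominates))) μ↑base≡)
                     (truncL-descends p (successor base) ℓ
                       λ i _ → proj₂ base-dominates _ (iterate-∈-cs (successor-∈-cs (proj₁ base-dominates)) i))

        μ↑-feasible-on-cs : FeasibleIn (CycArc cs) μ↑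
        μ↑-feasible-on-cs = σ↑
          , (λ u even (_ , arc) → subst (CycArc cs u) (trans (cs-arc arc) (successor-even even)) arc)
          , λ u w arc _ → subst (NonViolated μ↑ u) (sym (cs-arc arc)) (proj₂ (successor-arc u))

        -- The predicate of which IsThreshold τ μ base asks for the least element.
        ThresholdCandidate : Label → Set
        ThresholdCandidate x = Σ Labeling λ μ̃ → IsLabeling μ̃ × μ̃ base ≡ x × μ base ≤L μ̃ base ×
          (Σ (List V) λ cs′ → IsCycle τ cs′ × Dominates base cs′ × FeasibleIn (CycArc cs′) μ̃)

        base-settled : ∀ {ν} → BelowThresholds ν → Settled ν base
        base-settled {ν} below-thresholds with 2 ∣? π base
        ... | no  odd  = subst (ν base ≤L_) (sym (base-odd⇒top odd)) (x≤Ltop _)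
        ... | yes even = ≤L-stable {ν base} {μ↑ base} λ ν≰μ↑ →
            ¬¬-minimum ThresholdCandidate μ↑-candidate candidate∈L̄ λ (θ , threshold) →
              ν≰μ↑ (≤L-trans (below-thresholds base (cs , cs-IsCycle , base-dominates , even) θ threshold)
                             (proj₂ threshold (μ↑ base) μ↑-candidate))
          where
          μ↑-candidate : ThresholdCandidate (μ↑ base)
          μ↑-candidate = μ↑ , μ↑∈ , refl , μ≤μ↑ base , cs , cs-IsCycle , base-dominates , μ↑-feasible-on-cs

          candidate∈L̄ : ∀ {x} → ThresholdCandidate x → InL̄ x
          candidate∈L̄ (μ̃ , μ̃∈ , refl , _) = μ̃∈ base

        settled-on-cycle : ∀ {ν} → BelowThresholds ν → ∃ λ m → m < suc ℓ × Settled ν (orbit m)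
        settled-on-cycle {ν} below-thresholds
          with m , m<1+ℓ , base≡ ← ∈-applyUpTo⁻ orbit (proj₁ base-dominates)
          = m , m<1+ℓ , subst (Settled ν) base≡ (base-settled below-thresholds)

      orbit-meets-settled : ∀ {ν} → BelowThresholds ν → ∀ u → ∃ λ j → j ≤ n ∸ 1 × Settled ν (iterate successor u j)
      orbit-meets-settled {ν} below-thresholds u with lasso successor u
      ... | record { period = zero ; period>0 = () }
      ... | record { stem = s ; period = suc ℓ ; stem+period≤n = s+1+ℓ≤n
                   ; cycle-closes = closes ; cycle-distinct = distinct }
          with m , m<1+ℓ , settled ← OrbitCycle.settled-on-cycle (iterate successor u s) ℓ closes distinct {ν}
                                       below-thresholds
          = s + m , <⇒≤pred (≤-trans (+-monoʳ-< s m<1+ℓ) s+1+ℓ≤n)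
          , subst (Settled ν) (sym (iterate-+ successor u s m)) settled

      bellmanFord-returns-lift : ∀ {ν ν′} → IsLabeling ν → μ↑ ≤P ν → BelowThresholds ν →
                                 BellmanFord τ (n ∸ 1) ν ν′ → ∀ v → ν′ v ≡ μ↑ v
      bellmanFord-returns-lift ν∈ μ↑≤ν below-thresholds rounds v
        with (_ , μ↑≤ν′) , settles ← bellmanFord-settles rounds (ν∈ , μ↑≤ν)
        with j , j≤n-1 , settled ← orbit-meets-settled below-thresholds v
        = ≤L-antisym (settles v j j≤n-1 settled) (μ↑≤ν′ v)

theorem4p3 : ∀ {n : ℕ} (G : ParityGame n) (A : LinOrd) (T : Tree A) →
    let open Game G A T in
    (τ : OddStrategy) →
    Universal n (d / 2) T →
    (μ : Labeling) → IsLabeling μ →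
    (∀ v w → Eτ τ v w → ¬ Loose μ v w) →
    (μ↑ : Labeling) → IsLift τ μ μ↑ →
    (ν : Labeling) → IsLabeling ν →
    μ↑ ≤P ν →
    (∀ v → IsBase τ v → ∀ ξ → IsThreshold τ μ v ξ → ν v ≤L ξ) →
    (ν' : Labeling) → BellmanFord τ (n ∸ 1) ν ν' →
    ∀ v → ν' v ≡ μ↑ v
theorem4p3 G A T τ (height , _) _ μ∈ μ-¬loose _ lift _ ν∈ μ↑≤ν below-thresholds _ rounds =
  bellmanFord-returns-lift G A T height τ μ∈ μ-¬loose lift ν∈ μ↑≤ν below-thresholds rounds
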